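{- Let $(x,y,C) \in Q(r)$ with $r \ge 5$ and let $d(j_1,j_2) := 1 - y_{j_1,j_2}$. Fix $j^* \in J$ and $0 < \beta < 1$, and let $U := \{ j \in J \mid d(j,j^*) \le \beta\}$. Then $|U| \le \frac{c}{1-\beta}$.
   Context: $J$ is a finite set of unit-length jobs with a partial order $\prec$, and $m, S, c \in \mathbb{N}$. Sherali-Adams lift: for a polytope $K = \{x \in \mathbb{R}^N : Ax \ge b\}$ (whose constraints include $0 \le x_v \le 1$), $SA_r(K)$ is the set of vectors $X$ indexed by subsets of $[N]$ of size at most $r+1$ with $X_\emptyset = 1$ and, for all rows $\ell$ and all $I, H' \subseteq [N]$ with $|I| + |H'| \le r$: $\sum_{H \subseteq H'} (-1)^{|H|} \big(\sum_{v} A_{\ell,v} X_{I \cup H \cup \{v\}} - b_\ell X_{I \cup H}\big) \ge 0$. LP $Q(r)$: let $K$ be the set of vectors $(x_{j,i,s})_{j \in J, i \in [m], s \in \{0,\dots,S-1\}}$ with $\sum_{i \in [m]}\sum_{s} x_{j,i,s} = 1$ for all $j$, $\sum_{j \in J} x_{j,i,s} \le c$ for all $i,s$, and $0 \le x_{j,i,s} \le 1$. A lifted vector $x \in SA_r(K)$ has entries $x_{j,i,s}$ and $x_{(j_1,i_1,s_1),(j_2,i_2,s_2)}$ (entry of the index set $\{(j_1,i_1,s_1),(j_2,i_2,s_2)\}$). $Q(r)$ is the set of $(x,y,C)$ with $x \in SA_r(K)$, $y_{j_1,j_2} = \sum_{s=0}^{S-1}\sum_{i \in [m]} x_{(j_1,i,s),(j_2,i,s)}$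 for all $j_1,j_2$, $C_{j_2} \ge C_{j_1} + (1-y_{j_1,j_2})$ for all $j_1 \prec j_2$, and $C_j \ge 0$ for all $j$.
   Formalization: The LP solution $(x,y,C)$ has entries in ℚ rather than ℝ, and the parameter β is rational. -}

module Defs where

open import Data.Nat as ℕ using (ℕ; zero; suc)
open import Data.Fin as Fin using (Fin)
open import Data.Bool using (if_then_else_)
open import Data.Product using (_×_; _,_)
open import Data.List using (List; []; _∷_; _++_; map; length; concatMap; filter; allFin)
open import Data.List.Membership.Propositional using (_∈_)
open import Data.List.Relation.Unary.Unique.Propositional using (Unique)
open import Data.Integer using (+_)
open import Data.Rational using (ℚ; 0ℚ; 1ℚ; _+_; _*_; _-_; -_; _≤_; _<_; _≤?_; _/_; NonZero; positive)
open import Data.Rational.Properties using (+-monoˡ-<; +-inverseʳ; <-respˡ-≡; pos⇒nonZero)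
open import Relation.Nullary.Decidable using (⌊_⌋)
open import Relation.Binary.PropositionalEquality using (_≡_)

sumℚ : List ℚ → ℚ
sumℚ []       = 0ℚ
sumℚ (q ∷ qs) = q + sumℚ qs

-- all sublists of a list (= all subsets H ⊆ H' when H' has no duplicates)
sublists : {A : Set} → List A → List (List A)
sublists []       = [] ∷ []
sublists (a ∷ as) = sublists as ++ map (a ∷_) (sublists as)

sign : ℕ → ℚ
sign zero    = 1ℚ
sign (suc k) = - sign k

ℕ→ℚ : ℕ → ℚ
ℕ→ℚ k = (+ k) / 1

-- Sherali–Adams lift of K = {x : A x ≥ b} over variable set V
-- (enumerated without repetition by 'vars').  A lifted vector is
-- X : List V → ℚ, which is required to depend only on the underlying set
-- of the list, so that it is a vector indexed by subsets of V.  Only the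
-- entries of subsets of size ≤ r+1 are constrained.

SetEq : {V : Set} → List V → List V → Set
SetEq L L' = ∀ a → (a ∈ L → a ∈ L') × (a ∈ L' → a ∈ L)

record SA {V : Set} (vars : List V) {R : Set} (A : R → V → ℚ) (b : R → ℚ)
          (r : ℕ) (X : List V → ℚ) : Set where
  field
    X-empty  : X [] ≡ 1ℚ
    X-setIdx : ∀ L L' → SetEq L L' → X L ≡ X L'
    X-lifted : ∀ (ℓ : R) (I H' : List V) → Unique I → Unique H' →
               length I ℕ.+ length H' ℕ.≤ r →
               0ℚ ≤ sumℚ (map (λ H → sign (length H) *
                        (sumℚ (map (λ v → A ℓ v * X (I ++ H ++ v ∷ [])) vars)
                          - b ℓ * X (I ++ H)))
                      (sublists H'))

-- The polytope K of the scheduling LP.  Jobs J = Fin n, machines [m] = Fin m,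
-- time slots {0,…,S-1} = Fin S.

Var : ℕ → ℕ → ℕ → Set
Var n m S = Fin n × Fin m × Fin S

allVars : (n m S : ℕ) → List (Var n m S)
allVars n m S =
  concatMap (λ j → concatMap (λ i → map (λ s → (j , i , s)) (allFin S)) (allFin m)) (allFin n)

-- rows of A x ≥ b; the equality Σ_{i,s} x_{j,i,s} = 1 is written as two rows
data Row (n m S : ℕ) : Set where
  assign≥ : Fin n → Row n m S
  assign≤ : Fin n → Row n m S
  cap     : Fin m → Fin S → Row n m S
  lower   : Var n m S → Row n m S
  upper   : Var n m S → Row n m S

δ : ∀ {k} → Fin k → Fin k → ℚ
δ a b = if ⌊ a Fin.≟ b ⌋ then 1ℚ else 0ℚ

δV : ∀ {n m S} → Var n m S → Var n m S → ℚ
δV (j , i , s) (j' , i' , s') = δ j j' * δ i i' * δ s s'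

coeff : ∀ {n m S} → Row n m S → Var n m S → ℚ
coeff (assign≥ j) (j' , i , s) = δ j j'
coeff (assign≤ j) (j' , i , s) = - δ j j'
coeff (cap i s)   (j , i' , s') = - (δ i i' * δ s s')
coeff (lower v)   w = δV v w
coeff (upper v)   w = - δV v w

rhs : ∀ {n m S} → ℕ → Row n m S → ℚ
rhs c (assign≥ _) = 1ℚ
rhs c (assign≤ _) = - 1ℚ
rhs c (cap _ _)   = - ℕ→ℚ c
rhs c (lower _)   = 0ℚ
rhs c (upper _)   = - 1ℚ

record InQ (n m S c : ℕ) (_≺_ : Fin n → Fin n → Set) (r : ℕ)
           (x : List (Var n m S) → ℚ) (y : Fin n → Fin n → ℚ) (C : Fin n → ℚ) : Set where
  field
    x-SA   : SA (allVars n m S) coeff (rhs c) r x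
    y-def  : ∀ j₁ j₂ → y j₁ j₂ ≡
               sumℚ (map (λ s → sumℚ (map (λ i → x ((j₁ , i , s) ∷ (j₂ , i , s) ∷ []))
                                         (allFin m)))
                         (allFin S))
    C-prec : ∀ j₁ j₂ → j₁ ≺ j₂ → C j₁ + (1ℚ - y j₁ j₂) ≤ C j₂
    C-nonneg : ∀ j → 0ℚ ≤ C j

dist : ∀ {n} → (Fin n → Fin n → ℚ) → Fin n → Fin n → ℚ
dist y j₁ j₂ = 1ℚ - y j₁ j₂

U : ∀ {n} → (Fin n → Fin n → ℚ) → Fin n → ℚ → List (Fin n)
U {n} y j* β = filter (λ j → dist y j j* ≤? β) (allFin n)

1-β-nonZero : ∀ {β} → β < 1ℚ → NonZero (1ℚ - β)
1-β-nonZero {β} β<1 = pos⇒nonZero (1ℚ - β) {{positive (<-respˡ-≡ (+-inverseʳ β) (+-monoˡ-< (- β) β<1))}}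

{-# OPTIONS --safe #-}
module Submission where

-- Fix j*. Multiplying the capacity row of slot (i, s) by x_{j*,i,s} is a degree-2
-- Sherali–Adams constraint: Σ_j x_{(j*,i,s),(j,i,s)} ≤ c · x_{j*,i,s}. Summing over
-- (i, s) and using Σ_{i,s} x_{j*,i,s} ≤ 1 gives Σ_j y_{j,j*} ≤ c. The lifted bounds
-- x ≥ 0 make every y_{j,j*} nonnegative, and y_{j,j*} ≥ 1 - β for j ∈ U, so
-- |U| (1 - β) ≤ c.

open import Defs
open import Data.Nat using (ℕ; _≤_)
open import Data.Fin using (Fin)
open import Data.List using (List; length)
open import Data.Rational using (ℚ; 0ℚ; 1ℚ; _-_; _<_; _÷_) renaming (_≤_ to _≤ℚ_)
open import Relation.Binary.Structures using (IsStrictPartialOrder)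
open import Relation.Binary.PropositionalEquality using (_≡_)

open import Algebra.Bundles using (CommutativeRing)
open import Data.Fin using (zero; suc)
import Data.Fin as Fin
open import Data.Integer using (_◃_)
import Data.Integer as ℤ
open import Data.Integer.Properties using (+◃n≡+n)
open import Data.List using ([]; _∷_; _++_; map; concatMap; filter; allFin; tabulate)
open import Data.List.Properties using (map-tabulate; ++-identityʳ)
open import Data.List.Relation.Binary.Permutation.Propositional using (_↭_; ↭-refl; ↭-swap; ↭-sym)
open import Data.List.Relation.Binary.Permutation.Propositional.Properties using (∈-resp-↭)
open import Data.List.Relation.Unary.All using ([])
open import Data.List.Relation.Unary.AllPairs using ([]; _∷_)
open import Data.List.Relation.Unary.Unique.Propositional using (Unique)
open import Data.Nat using (zero; suc; z≤n; s≤s)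
open import Data.Nat.Coprimality using (1-coprimeTo) renaming (sym to coprime-sym)
import Data.Nat as ℕ
import Data.Nat.Properties as ℕₚ
open import Data.Product using (_,_)
open import Data.Rational using (mkℚ; _+_; _*_; -_; _/_; _≤?_; 1/_; Positive; positive)
open import Data.Rational.Properties
  using ( ≤-refl; ≤-reflexive; ≤-trans; +-mono-≤; +-monoʳ-≤; +-monoˡ-<; <-respˡ-≡; neg-antimono-≤
        ; +-identityˡ; +-identityʳ; +-assoc; +-inverseʳ; *-identityˡ; *-identityʳ; *-zeroˡ; *-assoc
        ; *-distribʳ-+; *-monoˡ-≤-nonNeg; neg-distribˡ-*; *-inverseˡ; *-cancelʳ-≤-pos; pos⇒nonZero
        ; normalize-coprime; normalize-nonNeg; +-*-commutativeRing; module ≤-Reasoning)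
open import Data.Rational.Solver using (module +-*-Solver)
import Data.Sign as Sign
open import Function.Base using (id; _∘_)
open import Relation.Binary.PropositionalEquality
  using (refl; sym; trans; cong; cong₂; subst₂; module ≡-Reasoning)
open import Relation.Nullary using (yes; no)
open import Relation.Unary using (Decidable)

open import Algebra.Properties.Ring (CommutativeRing.ring +-*-commutativeRing)
  using (-1*x≈-x; -‿involutive)
open import Algebra.Properties.Semiring.Sum (CommutativeRing.semiring +-*-commutativeRing)
  using (sum; sum-syntax; sum-cong-≗; sum-replicate-zero; ∑-comm; *-distribˡ-sum)
open +-*-Solver using (solve; _:=_; _:+_; _:-_)

ℕ→ℚ-suc : ∀ k → ℕ→ℚ (suc k) ≡ 1ℚ + ℕ→ℚ k
ℕ→ℚ-suc k = begin
  ℤ.+ suc k / 1                                    ≡⟨ cong (λ i → (ℤ.+ 1 ℤ.+ i) / 1) +k≡+◃k*1 ⟩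
  (ℤ.+ 1 ℤ.+ (Sign.+ ◃ k ℕ.* 1)) / 1               ≡⟨⟩  -- unfolding _+_ on normal forms
  1ℚ + mkℚ (ℤ.+ k) 0 k/1-coprime                   ≡⟨ cong (1ℚ +_) (sym (normalize-coprime k/1-coprime)) ⟩
  1ℚ + ℕ→ℚ k                                       ∎
  where
  open ≡-Reasoning
  k/1-coprime = coprime-sym (1-coprimeTo k)
  +k≡+◃k*1 : ℤ.+ k ≡ Sign.+ ◃ k ℕ.* 1
  +k≡+◃k*1 = trans (sym (+◃n≡+n k)) (cong (Sign.+ ◃_) (sym (ℕₚ.*-identityʳ k)))

0≤p-q⇒q≤p : ∀ {p q} → 0ℚ ≤ℚ p - q → q ≤ℚ p
0≤p-q⇒q≤p {p} {q} 0≤p-q = begin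
  q            ≡⟨ sym (+-identityʳ q) ⟩
  q + 0ℚ       ≤⟨ +-monoʳ-≤ q 0≤p-q ⟩
  q + (p - q)  ≡⟨ solve 2 (λ p q → q :+ (p :- q) := p) refl p q ⟩
  p            ∎
  where open ≤-Reasoning

p-q≤r⇒p-r≤q : ∀ {p q r} → p - q ≤ℚ r → p - r ≤ℚ q
p-q≤r⇒p-r≤q {p} {q} {r} p-q≤r = begin
  p - r        ≤⟨ +-monoʳ-≤ p (neg-antimono-≤ p-q≤r) ⟩
  p - (p - q)  ≡⟨ solve 2 (λ p q → p :- (p :- q) := q) refl p q ⟩
  q            ∎
  where open ≤-Reasoning

neg-cancel-≤ : ∀ {p q} → - p ≤ℚ - q → q ≤ℚ p
neg-cancel-≤ {p} {q} -p≤-q = subst₂ _≤ℚ_ (-‿involutive q) (-‿involutive p) (neg-antimono-≤ -p≤-q)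

p<q⇒0<q-p : ∀ {p q} → p < q → 0ℚ < q - p
p<q⇒0<q-p {p} p<q = <-respˡ-≡ (+-inverseʳ p) (+-monoˡ-< (- p) p<q)

p*q≤r⇒p≤r÷q : ∀ {p r} q .{{_ : Positive q}} → p * q ≤ℚ r → p ≤ℚ (r ÷ q) {{pos⇒nonZero q}}
p*q≤r⇒p≤r÷q {p} {r} q p*q≤r = *-cancelʳ-≤-pos q (begin
  p * q                  ≤⟨ p*q≤r ⟩
  r                      ≡⟨ sym (*-identityʳ r) ⟩
  r * 1ℚ                 ≡⟨ cong (r *_) (sym (*-inverseˡ q)) ⟩
  r * (1/ q * q)         ≡⟨ sym (*-assoc r (1/ q) q) ⟩
  r * 1/ q * q           ∎)
  where
  open ≤-Reasoning
  instance _ = pos⇒nonZero q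

∑-mono-≤ : ∀ {k} {f g : Fin k → ℚ} → (∀ i → f i ≤ℚ g i) → sum f ≤ℚ sum g
∑-mono-≤ {zero}  f≤g = ≤-refl
∑-mono-≤ {suc k} f≤g = +-mono-≤ (f≤g zero) (∑-mono-≤ (f≤g ∘ suc))

∑-nonNeg : ∀ {k} {f : Fin k → ℚ} → (∀ i → 0ℚ ≤ℚ f i) → 0ℚ ≤ℚ sum f
∑-nonNeg {k} 0≤f = ≤-trans (≤-reflexive (sym (sum-replicate-zero k))) (∑-mono-≤ 0≤f)

δ-suc : ∀ {k} (a b : Fin k) → δ (suc a) (suc b) ≡ δ a b
δ-suc a b with a Fin.≟ b
... | yes _ = refl
... | no  _ = refl

∑-δ : ∀ {k} (a : Fin k) (f : Fin k → ℚ) → ∑[ b < k ] (δ a b * f b) ≡ f a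
∑-δ {suc k} zero f = begin
  1ℚ * f zero + ∑[ b < k ] (0ℚ * f (suc b))  ≡⟨ cong₂ _+_ (*-identityˡ (f zero)) ∑0*f≡0 ⟩
  f zero + 0ℚ                                ≡⟨ +-identityʳ (f zero) ⟩
  f zero                                     ∎
  where
  open ≡-Reasoning
  ∑0*f≡0 : ∑[ b < k ] (0ℚ * f (suc b)) ≡ 0ℚ
  ∑0*f≡0 = trans (sum-cong-≗ (*-zeroˡ ∘ f ∘ suc)) (sum-replicate-zero k)
∑-δ {suc k} (suc a) f = begin
  0ℚ * f zero + ∑[ b < k ] (δ (suc a) (suc b) * f (suc b))  ≡⟨ cong₂ _+_ (*-zeroˡ (f zero)) ∑δf≡f ⟩
  0ℚ + f (suc a)                                           ≡⟨ +-identityˡ (f (suc a)) ⟩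
  f (suc a)                                                ∎
  where
  open ≡-Reasoning
  ∑δf≡f : ∑[ b < k ] (δ (suc a) (suc b) * f (suc b)) ≡ f (suc a)
  ∑δf≡f = trans (sum-cong-≗ (λ b → cong (_* f (suc b)) (δ-suc a b))) (∑-δ a (f ∘ suc))

∑-*δ : ∀ {k} (c : ℚ) (a : Fin k) (f : Fin k → ℚ) → ∑[ b < k ] (c * δ a b * f b) ≡ c * f a
∑-*δ {k} c a f = begin
  ∑[ b < k ] (c * δ a b * f b)    ≡⟨ sum-cong-≗ (λ b → *-assoc c (δ a b) (f b)) ⟩
  ∑[ b < k ] (c * (δ a b * f b))  ≡⟨ sym (*-distribˡ-sum c (λ b → δ a b * f b)) ⟩
  c * ∑[ b < k ] (δ a b * f b)    ≡⟨ cong (c *_) (∑-δ a f) ⟩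
  c * f a                         ∎
  where open ≡-Reasoning

sumℚ-++ : ∀ {A : Set} (f : A → ℚ) (xs ys : List A) →
          sumℚ (map f (xs ++ ys)) ≡ sumℚ (map f xs) + sumℚ (map f ys)
sumℚ-++ f []       ys = sym (+-identityˡ _)
sumℚ-++ f (x ∷ xs) ys = trans (cong (f x +_) (sumℚ-++ f xs ys)) (sym (+-assoc (f x) _ _))

sumℚ-concatMap : ∀ {A B : Set} (f : B → ℚ) (g : A → List B) (xs : List A) →
                 sumℚ (map f (concatMap g xs)) ≡ sumℚ (map (λ a → sumℚ (map f (g a))) xs)
sumℚ-concatMap f g []       = refl
sumℚ-concatMap f g (x ∷ xs) =
  trans (sumℚ-++ f (g x) (concatMap g xs)) (cong (sumℚ (map f (g x)) +_) (sumℚ-concatMap f g xs))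

sumℚ-tabulate : ∀ {A : Set} {k} (f : A → ℚ) (g : Fin k → A) →
                sumℚ (map f (tabulate g)) ≡ ∑[ i < k ] f (g i)
sumℚ-tabulate {k = zero}  f g = refl
sumℚ-tabulate {k = suc k} f g = cong (f (g zero) +_) (sumℚ-tabulate f (g ∘ suc))

sumℚ-allVars : ∀ {n m S} (f : Var n m S → ℚ) →
               sumℚ (map f (allVars n m S)) ≡ ∑[ j < n ] ∑[ i < m ] ∑[ s < S ] f (j , i , s)
sumℚ-allVars {n} {m} {S} f = begin
  sumℚ (map f (allVars n m S))
    ≡⟨ sumℚ-concatMap f jobVars (allFin n) ⟩
  sumℚ (map (sumℚ ∘ map f ∘ jobVars) (allFin n))
    ≡⟨ sumℚ-tabulate (sumℚ ∘ map f ∘ jobVars) id ⟩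
  ∑[ j < n ] sumℚ (map f (jobVars j))
    ≡⟨ sum-cong-≗ (λ j → trans (sumℚ-concatMap f (slotVars j) (allFin m))
                               (sumℚ-tabulate (sumℚ ∘ map f ∘ slotVars j) id)) ⟩
  ∑[ j < n ] ∑[ i < m ] sumℚ (map f (slotVars j i))
    ≡⟨ sum-cong-≗ (λ j → sum-cong-≗ (sumℚ-slotVars j)) ⟩
  ∑[ j < n ] ∑[ i < m ] ∑[ s < S ] f (j , i , s)
    ∎
  where
  open ≡-Reasoning
  slotVars : Fin n → Fin m → List (Var n m S)
  slotVars j i = map (λ s → (j , i , s)) (allFin S)
  jobVars : Fin n → List (Var n m S)
  jobVars j = concatMap (slotVars j) (allFin m)
  sumℚ-slotVars : ∀ j i → sumℚ (map f (slotVars j i)) ≡ ∑[ s < S ] f (j , i , s)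
  sumℚ-slotVars j i = trans (cong (sumℚ ∘ map f) (map-tabulate id (λ s → (j , i , s))))
                            (sumℚ-tabulate f (λ s → (j , i , s)))

length-filter*≤sumℚ : ∀ {A : Set} {P : A → Set} (P? : Decidable P) {t : ℚ} {g : A → ℚ} →
                      (∀ a → 0ℚ ≤ℚ g a) → (∀ {a} → P a → t ≤ℚ g a) →
                      ∀ xs → ℕ→ℚ (length (filter P? xs)) * t ≤ℚ sumℚ (map g xs)
length-filter*≤sumℚ P? {t} {g} 0≤g t≤g = go
  where
  open ≤-Reasoning
  go : ∀ xs → ℕ→ℚ (length (filter P? xs)) * t ≤ℚ sumℚ (map g xs)
  go []       = ≤-reflexive (*-zeroˡ t)
  go (a ∷ xs) with P? a
  ... | yes Pa = begin
    ℕ→ℚ (suc k) * t        ≡⟨ cong (_* t) (ℕ→ℚ-suc k) ⟩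
    (1ℚ + ℕ→ℚ k) * t       ≡⟨ *-distribʳ-+ t 1ℚ (ℕ→ℚ k) ⟩
    1ℚ * t + ℕ→ℚ k * t     ≡⟨ cong (_+ ℕ→ℚ k * t) (*-identityˡ t) ⟩
    t + ℕ→ℚ k * t          ≤⟨ +-mono-≤ (t≤g Pa) (go xs) ⟩
    g a + sumℚ (map g xs)  ∎
    where k = length (filter P? xs)
  ... | no _ = begin
    ℕ→ℚ k * t              ≡⟨ sym (+-identityˡ (ℕ→ℚ k * t)) ⟩
    0ℚ + ℕ→ℚ k * t         ≤⟨ +-mono-≤ (0≤g a) (go xs) ⟩
    g a + sumℚ (map g xs)  ∎
    where k = length (filter P? xs)

module _ {V : Set} {vars : List V} {R : Set} {A : R → V → ℚ} {b : R → ℚ} {r : ℕ} {X : List V → ℚ}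
         (sa : SA vars A b r X) where

  X-lifted-[] : ∀ ℓ I → Unique I → length I ≤ r →
                b ℓ * X I ≤ℚ sumℚ (map (λ v → A ℓ v * X (I ++ v ∷ [])) vars)
  X-lifted-[] ℓ I unique-I |I|≤r = 0≤p-q⇒q≤p (≤-trans lifted (≤-reflexive simplify))
    where
    L : ℚ
    L = sumℚ (map (λ v → A ℓ v * X (I ++ v ∷ [])) vars)
    lifted : 0ℚ ≤ℚ 1ℚ * (L - b ℓ * X (I ++ [])) + 0ℚ
    lifted = SA.X-lifted sa ℓ I [] unique-I []
               (ℕₚ.≤-trans (ℕₚ.≤-reflexive (ℕₚ.+-identityʳ (length I))) |I|≤r)
    simplify : 1ℚ * (L - b ℓ * X (I ++ [])) + 0ℚ ≡ L - b ℓ * X I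
    simplify = trans (+-identityʳ _) (trans (*-identityˡ _) (cong (λ J → L - b ℓ * X J) (++-identityʳ I)))

  X-pair-comm : ∀ u v → X (u ∷ v ∷ []) ≡ X (v ∷ u ∷ [])
  X-pair-comm u v = SA.X-setIdx sa _ _ (λ a → ∈-resp-↭ uv↭vu , ∈-resp-↭ (↭-sym uv↭vu))
    where
    uv↭vu : u ∷ v ∷ [] ↭ v ∷ u ∷ []
    uv↭vu = ↭-swap u v ↭-refl

module _ {n m S : ℕ} where

  sum-coeff-lower : ∀ v (f : Var n m S → ℚ) →
                    sumℚ (map (λ w → coeff (lower v) w * f w) (allVars n m S)) ≡ f v
  sum-coeff-lower (j , i , s) f = begin
    sumℚ (map (λ w → coeff (lower (j , i , s)) w * f w) (allVars n m S))
      ≡⟨ sumℚ-allVars (λ w → coeff (lower (j , i , s)) w * f w) ⟩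
    ∑[ j′ < n ] ∑[ i′ < m ] ∑[ s′ < S ] (δ j j′ * δ i i′ * δ s s′ * f (j′ , i′ , s′))
      ≡⟨ sum-cong-≗ (λ j′ → trans (sum-cong-≗ (λ i′ → ∑-*δ (δ j j′ * δ i i′) s (λ s′ → f (j′ , i′ , s′))))
                                  (∑-*δ (δ j j′) i (λ i′ → f (j′ , i′ , s)))) ⟩
    ∑[ j′ < n ] (δ j j′ * f (j′ , i , s))
      ≡⟨ ∑-δ j (λ j′ → f (j′ , i , s)) ⟩
    f (j , i , s)
      ∎
    where open ≡-Reasoning

  sum-coeff-cap : ∀ i s (f : Var n m S → ℚ) →
                  sumℚ (map (λ w → coeff (cap i s) w * f w) (allVars n m S)) ≡
                  - ∑[ j < n ] f (j , i , s)
  sum-coeff-cap i s f = begin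
    sumℚ (map (λ w → coeff (cap i s) w * f w) (allVars n m S))
      ≡⟨ sumℚ-allVars (λ w → coeff (cap i s) w * f w) ⟩
    ∑[ j < n ] ∑[ i′ < m ] ∑[ s′ < S ] (- (δ i i′ * δ s s′) * f (j , i′ , s′))
      ≡⟨ sum-cong-≗ (λ j → sum-cong-≗ (λ i′ → sum-cong-≗ (λ s′ →
           cong (_* f (j , i′ , s′)) (-[a*b]≡-1*a*b (δ i i′) (δ s s′))))) ⟩
    ∑[ j < n ] ∑[ i′ < m ] ∑[ s′ < S ] (- 1ℚ * δ i i′ * δ s s′ * f (j , i′ , s′))
      ≡⟨ sum-cong-≗ (λ j → trans (sum-cong-≗ (λ i′ → ∑-*δ (- 1ℚ * δ i i′) s (λ s′ → f (j , i′ , s′))))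
                                 (∑-*δ (- 1ℚ) i (λ i′ → f (j , i′ , s)))) ⟩
    ∑[ j < n ] (- 1ℚ * f (j , i , s))
      ≡⟨ sym (*-distribˡ-sum (- 1ℚ) (λ j → f (j , i , s))) ⟩
    - 1ℚ * ∑[ j < n ] f (j , i , s)
      ≡⟨ -1*x≈-x _ ⟩
    - ∑[ j < n ] f (j , i , s)
      ∎
    where
    open ≡-Reasoning
    -[a*b]≡-1*a*b : ∀ a b → - (a * b) ≡ - 1ℚ * a * b
    -[a*b]≡-1*a*b a b = trans (neg-distribˡ-* a b) (cong (_* b) (sym (-1*x≈-x a)))

  sum-coeff-assign≤ : ∀ j (f : Var n m S → ℚ) →
                      sumℚ (map (λ w → coeff (assign≤ j) w * f w) (allVars n m S)) ≡
                      - ∑[ i < m ] ∑[ s < S ] f (j , i , s)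
  sum-coeff-assign≤ j f = begin
    sumℚ (map (λ w → coeff (assign≤ j) w * f w) (allVars n m S))
      ≡⟨ sumℚ-allVars (λ w → coeff (assign≤ j) w * f w) ⟩
    ∑[ j′ < n ] ∑[ i < m ] ∑[ s < S ] (- δ j j′ * f (j′ , i , s))
      ≡⟨ sum-cong-≗ (λ j′ → trans (sum-cong-≗ (λ i → sym (*-distribˡ-sum (- δ j j′) (λ s → f (j′ , i , s)))))
                                  (sym (*-distribˡ-sum (- δ j j′) (λ i → ∑[ s < S ] f (j′ , i , s))))) ⟩
    ∑[ j′ < n ] (- δ j j′ * F j′)
      ≡⟨ sum-cong-≗ (λ j′ → cong (_* F j′) (sym (-1*x≈-x (δ j j′)))) ⟩
    ∑[ j′ < n ] (- 1ℚ * δ j j′ * F j′)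
      ≡⟨ ∑-*δ (- 1ℚ) j F ⟩
    - 1ℚ * F j
      ≡⟨ -1*x≈-x (F j) ⟩
    - F j
      ∎
    where
    open ≡-Reasoning
    F : Fin n → ℚ
    F j′ = ∑[ i < m ] ∑[ s < S ] f (j′ , i , s)

module _ {n m S c r : ℕ} {X : List (Var n m S) → ℚ} (sa : SA (allVars n m S) coeff (rhs c) r X) where

  X-pair-nonNeg : 1 ≤ r → ∀ u v → 0ℚ ≤ℚ X (u ∷ v ∷ [])
  X-pair-nonNeg 1≤r u v = begin
    0ℚ                  ≡⟨ sym (*-zeroˡ (X (u ∷ []))) ⟩
    0ℚ * X (u ∷ [])     ≤⟨ X-lifted-[] sa (lower v) (u ∷ []) ([] ∷ []) 1≤r ⟩
    sumℚ (map (λ w → coeff (lower v) w * X (u ∷ w ∷ [])) (allVars n m S))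
                        ≡⟨ sum-coeff-lower v (λ w → X (u ∷ w ∷ [])) ⟩
    X (u ∷ v ∷ [])      ∎
    where open ≤-Reasoning

  ∑-X-pair≤c*X : 1 ≤ r → ∀ u i s → ∑[ j < n ] X (u ∷ (j , i , s) ∷ []) ≤ℚ ℕ→ℚ c * X (u ∷ [])
  ∑-X-pair≤c*X 1≤r u i s = neg-cancel-≤ (begin
    - (ℕ→ℚ c * X (u ∷ []))   ≡⟨ neg-distribˡ-* (ℕ→ℚ c) (X (u ∷ [])) ⟩
    - ℕ→ℚ c * X (u ∷ [])     ≤⟨ X-lifted-[] sa (cap i s) (u ∷ []) ([] ∷ []) 1≤r ⟩
    sumℚ (map (λ w → coeff (cap i s) w * X (u ∷ w ∷ [])) (allVars n m S))
                             ≡⟨ sum-coeff-cap i s (λ w → X (u ∷ w ∷ [])) ⟩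
    - ∑[ j < n ] X (u ∷ (j , i , s) ∷ []) ∎)
    where open ≤-Reasoning

  ∑-X-singleton≤1 : ∀ j → ∑[ i < m ] ∑[ s < S ] X ((j , i , s) ∷ []) ≤ℚ 1ℚ
  ∑-X-singleton≤1 j = neg-cancel-≤ (begin
    - 1ℚ              ≡⟨ sym (*-identityʳ (- 1ℚ)) ⟩
    - 1ℚ * 1ℚ         ≡⟨ cong (- 1ℚ *_) (sym (SA.X-empty sa)) ⟩
    - 1ℚ * X []       ≤⟨ X-lifted-[] sa (assign≤ j) [] [] z≤n ⟩
    sumℚ (map (λ w → coeff (assign≤ j) w * X (w ∷ [])) (allVars n m S))
                      ≡⟨ sum-coeff-assign≤ j (λ w → X (w ∷ [])) ⟩
    - ∑[ i < m ] ∑[ s < S ] X ((j , i , s) ∷ []) ∎)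
    where open ≤-Reasoning

module _ {n m S c : ℕ} {_≺_ : Fin n → Fin n → Set} {r : ℕ} {x : List (Var n m S) → ℚ}
         {y : Fin n → Fin n → ℚ} {C : Fin n → ℚ} (inQ : InQ n m S c _≺_ r x y C) where

  open InQ inQ

  y≡∑-x-pair : ∀ j j′ → y j j′ ≡ ∑[ s < S ] ∑[ i < m ] x ((j′ , i , s) ∷ (j , i , s) ∷ [])
  y≡∑-x-pair j j′ = begin
    y j j′
      ≡⟨ y-def j j′ ⟩
    sumℚ (map (λ s → sumℚ (map (x[j,j′] s) (allFin m))) (allFin S))
      ≡⟨ trans (sumℚ-tabulate (λ s → sumℚ (map (x[j,j′] s) (allFin m))) id)
               (sum-cong-≗ (λ s → sumℚ-tabulate (x[j,j′] s) id)) ⟩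
    ∑[ s < S ] ∑[ i < m ] x[j,j′] s i
      ≡⟨ sum-cong-≗ (λ s → sum-cong-≗ (λ i → X-pair-comm x-SA (j , i , s) (j′ , i , s))) ⟩
    ∑[ s < S ] ∑[ i < m ] x ((j′ , i , s) ∷ (j , i , s) ∷ []) ∎
    where
    open ≡-Reasoning
    x[j,j′] : Fin S → Fin m → ℚ
    x[j,j′] s i = x ((j , i , s) ∷ (j′ , i , s) ∷ [])

  y-nonNeg : 1 ≤ r → ∀ j j′ → 0ℚ ≤ℚ y j j′
  y-nonNeg 1≤r j j′ = ≤-trans
    (∑-nonNeg (λ s → ∑-nonNeg (λ i → X-pair-nonNeg x-SA 1≤r (j′ , i , s) (j , i , s))))
    (≤-reflexive (sym (y≡∑-x-pair j j′)))

  ∑-y≤c : 1 ≤ r → ∀ j′ → ∑[ j < n ] y j j′ ≤ℚ ℕ→ℚ c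
  ∑-y≤c 1≤r j′ = begin
    ∑[ j < n ] y j j′
      ≡⟨ sum-cong-≗ (λ j → y≡∑-x-pair j j′) ⟩
    ∑[ j < n ] ∑[ s < S ] ∑[ i < m ] x ((j′ , i , s) ∷ (j , i , s) ∷ [])
      ≡⟨ trans (∑-comm (λ j s → ∑[ i < m ] x ((j′ , i , s) ∷ (j , i , s) ∷ [])))
               (sum-cong-≗ (λ s → ∑-comm (λ j i → x ((j′ , i , s) ∷ (j , i , s) ∷ [])))) ⟩
    ∑[ s < S ] ∑[ i < m ] ∑[ j < n ] x ((j′ , i , s) ∷ (j , i , s) ∷ [])
      ≤⟨ ∑-mono-≤ (λ s → ∑-mono-≤ (λ i → ∑-X-pair≤c*X x-SA 1≤r (j′ , i , s) i s)) ⟩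
    ∑[ s < S ] ∑[ i < m ] (ℕ→ℚ c * x ((j′ , i , s) ∷ []))
      ≡⟨ trans (sum-cong-≗ (λ s → sym (*-distribˡ-sum (ℕ→ℚ c) (λ i → x ((j′ , i , s) ∷ [])))))
               (sym (*-distribˡ-sum (ℕ→ℚ c) (λ s → ∑[ i < m ] x ((j′ , i , s) ∷ [])))) ⟩
    ℕ→ℚ c * ∑[ s < S ] ∑[ i < m ] x ((j′ , i , s) ∷ [])
      ≡⟨ cong (ℕ→ℚ c *_) (∑-comm (λ s i → x ((j′ , i , s) ∷ []))) ⟩
    ℕ→ℚ c * ∑[ i < m ] ∑[ s < S ] x ((j′ , i , s) ∷ [])
      ≤⟨ *-monoˡ-≤-nonNeg (ℕ→ℚ c) {{normalize-nonNeg c 1}} (∑-X-singleton≤1 x-SA j′) ⟩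
    ℕ→ℚ c * 1ℚ
      ≡⟨ *-identityʳ (ℕ→ℚ c) ⟩
    ℕ→ℚ c ∎
    where open ≤-Reasoning

-- Only the degree-2 entries of the lift are used, so r ≥ 1 would do; neither 0 < β,
-- the precedence order nor C plays a role.
lemma11 : (n m S c : ℕ) (_≺_ : Fin n → Fin n → Set) → IsStrictPartialOrder _≡_ _≺_ →
          (r : ℕ) → 5 ≤ r →
          (x : List (Var n m S) → ℚ) (y : Fin n → Fin n → ℚ) (C : Fin n → ℚ) →
          InQ n m S c _≺_ r x y C →
          (j* : Fin n) (β : ℚ) → 0ℚ < β → (β<1 : β < 1ℚ) →
          ℕ→ℚ (length (U y j* β)) ≤ℚ _÷_ (ℕ→ℚ c) (1ℚ - β) {{1-β-nonZero β<1}}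
lemma11 n _ _ c _ _ r 5≤r _ y _ inQ j* β _ β<1 =
  p*q≤r⇒p≤r÷q (1ℚ - β) {{positive (p<q⇒0<q-p β<1)}} (begin
    ℕ→ℚ (length (U y j* β)) * (1ℚ - β)
      ≤⟨ length-filter*≤sumℚ (λ j → dist y j j* ≤? β) (λ j → y-nonNeg inQ 1≤r j j*)
                             (p-q≤r⇒p-r≤q {1ℚ}) (allFin n) ⟩
    sumℚ (map (λ j → y j j*) (allFin n))
      ≡⟨ sumℚ-tabulate (λ j → y j j*) id ⟩
    ∑[ j < n ] y j j*
      ≤⟨ ∑-y≤c inQ 1≤r j* ⟩
    ℕ→ℚ c ∎)
  where
  open ≤-Reasoning
  1≤r : 1 ≤ r
  1≤r = ℕₚ.≤-trans (s≤s z≤n) 5≤r
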